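{- Let $t\ge 3$ and let $\mathcal{H}$ be an $n$-vertex $3$-uniform hypergraph that does not contain $K_{2,t}$ as a trace. Let $A$ be the set of edges of $\mathcal{H}$ that contain at least one pair $\{x,y\}$ with $d_{\mathcal{H}}(x,y)=1$, and let $B=\mathcal{H}\setminus A$. For a vertex $x$, let $N_1(x)$ be the set of vertices $z$ such that some edge of $B$ contains $\{x,z\}$. Then for any two distinct vertices $x,y\in V(\mathcal{H})$, $|N_1(x)\cap N_1(y)|\le (t-1)(6t-2)$.
   Context: A hypergraph $\mathcal{H}$ contains a graph $F$ (vertices $v_1,\ldots,v_p$, edges $e_1,\ldots,e_q$) as a trace if there exist distinct vertices $w_1,\ldots,w_p\in V(\mathcal{H})$ and distinct edges $f_1,\ldots,f_q\in E(\mathcal{H})$ such that whenever $e_i=v_\alpha v_\beta$ we have $f_i\cap\{w_1,\ldots,w_p\}=\{w_\alpha,w_\beta\}$. The co-degree $d_{\mathcal{H}}(x,y)$ is the number of edges of $\mathcal{H}$ containing $\{x,y\}$. $\mathcal{H}\setminus A$ denotes the hypergraph on $V(\mathcal{H})$ with edge set $E(\mathcal{H})\setminus A$. -}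

module Defs where

open import Data.Nat using (ℕ; _≤_)
open import Data.Fin using (Fin)
open import Data.Fin.Subset using (Subset; _∈_; ∣_∣)
open import Data.Fin.Subset.Properties using (_∈?_)
open import Data.List using (List; length; filter)
open import Data.List.Membership.Propositional renaming (_∈_ to _∈ₗ_)
open import Data.List.Relation.Unary.All using (All)
open import Data.List.Relation.Unary.Unique.Propositional using (Unique)
open import Data.Product using (Σ; _×_; ∃; ∃-syntax)
open import Relation.Nullary using (¬_)
open import Relation.Nullary.Decidable using (_×-dec_)
open import Relation.Binary.PropositionalEquality using (_≡_; _≢_)
open import Function.Bundles using (_⇔_)

record Hypergraph (n : ℕ) : Set where
  field
    edges  : List (Subset n)
    unique : Unique edges
open Hypergraph public

Uniform3 : ∀ {n} → Hypergraph n → Set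
Uniform3 H = All (λ e → ∣ e ∣ ≡ 3) (edges H)

codeg : ∀ {n} → Hypergraph n → Fin n → Fin n → ℕ
codeg H x y = length (filter (λ e → (x ∈? e) ×-dec (y ∈? e)) (edges H))

-- H contains K_{2,t} as a trace: distinct vertices a₁,a₂ (class of size 2) and
-- b₁..b_t (class of size t), and distinct edges f(i,j) of H with
-- f(i,j) ∩ {a's, b's} = {a_i, b_j}.
ContainsK2tTrace : ∀ {n} → ℕ → Hypergraph n → Set
ContainsK2tTrace {n} t H =
  Σ (Fin 2 → Fin n) λ a → Σ (Fin t → Fin n) λ b →
  Σ (Fin 2 → Fin t → Subset n) λ f →
      (∀ i i' → a i ≡ a i' → i ≡ i')
    × (∀ j j' → b j ≡ b j' → j ≡ j')
    × (∀ i j → a i ≢ b j)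
    × (∀ i j → f i j ∈ₗ edges H)
    × (∀ i j i' j' → f i j ≡ f i' j' → (i ≡ i' × j ≡ j'))
    × (∀ i j → (∀ k → (a k ∈ f i j) ⇔ (k ≡ i)) × (∀ l → (b l ∈ f i j) ⇔ (l ≡ j)))

HasCodeg1Pair : ∀ {n} → Hypergraph n → Subset n → Set
HasCodeg1Pair H e = ∃[ x ] ∃[ y ] (x ≢ y × x ∈ e × y ∈ e × codeg H x y ≡ 1)

InA : ∀ {n} → Hypergraph n → Subset n → Set
InA H e = e ∈ₗ edges H × HasCodeg1Pair H e

InB : ∀ {n} → Hypergraph n → Subset n → Set
InB H e = e ∈ₗ edges H × ¬ HasCodeg1Pair H e

InN1 : ∀ {n} → Hypergraph n → Fin n → Fin n → Set
InN1 H x z = z ≢ x × ∃[ e ] (InB H e × x ∈ e × z ∈ e)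

-- For every common vertex z of N₁(x) and N₁(y) choose an edge through x and z missing y
-- and an edge through y and z missing x: they exist because a pair lying in a B-edge has
-- co-degree at least 2, and two distinct 3-edges share at most two vertices.  Say z hits z′
-- if z′ lies on one of the two edges chosen for z.  Each such edge has only one vertex
-- besides x (resp. y) and z, so every z hits at most two others, and two greedy passes find
-- at least a ninth of the common vertices pairwise non-hitting.  Their chosen edges together
-- with x and y form a trace of K_{2,s} for s such vertices, so s < t and there are at most
-- 9 (t - 1) ≤ (t - 1)(6t - 2) common vertices.
module Submission where

open import Defs
open import Data.Nat using (ℕ; zero; suc; _≤_; _<_; s≤s⁻¹; _+_; _*_; _∸_; z≤n; s≤s)
open import Data.Nat.Properties
  using ( ≤-refl; ≤-trans; ≤-reflexive; _≤?_; <⇒≱; ≰⇒>; n≤1+n; m≤m+n; +-suc; *-suc; *-assoc; *-comm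
        ; +-monoʳ-≤; +-mono-≤; *-monoʳ-≤; *-monoˡ-≤; ∸-monoˡ-≤; module ≤-Reasoning )
open import Data.Fin using (Fin; zero; suc; inject≤)
open import Data.Fin.Properties using (_≟_; inject≤-injective)
open import Data.Fin.Subset using (Subset; _∈_; _∉_; _⊆_; ∣_∣; _-_)
open import Data.Fin.Subset.Properties using (_∈?_; x∈p∧x≢y⇒x∈p-y; x∈p⇒∣p-x∣<∣p∣; ⊆-antisym)
open import Data.List using (List; []; _∷_; _++_; length; filter; map; lookup; reverse)
open import Data.List.Properties using (length-++; length-map; length-filter; length-reverse; unfold-reverse)
open import Data.List.Membership.Propositional using () renaming (_∈_ to _∈ₗ_)
open import Data.List.Membership.Propositional.Properties using (∈-filter⁺; ∈-filter⁻; ∈-lookup)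
import Data.List.Membership.DecPropositional as DecMembership
open import Data.List.Relation.Unary.Any using (here; there)
open import Data.List.Relation.Unary.All as All using (All; []; _∷_)
import Data.List.Relation.Unary.All.Properties as All
open import Data.List.Relation.Unary.AllPairs as AllPairs using (AllPairs; []; _∷_)
import Data.List.Relation.Unary.AllPairs.Properties as AllPairs
open import Data.List.Relation.Unary.Unique.Propositional using (Unique)
import Data.List.Relation.Unary.Unique.Propositional.Properties as Unique
import Data.Product as Product
open import Data.Product using (Σ; _×_; _,_; proj₁; proj₂)
open import Data.Sum using (_⊎_; inj₁; inj₂)
open import Data.Empty using (⊥-elim)
open import Function using (flip)
open import Function.Bundles using (_⇔_; mk⇔; Equivalence)
open import Relation.Nullary using (¬_; yes; no)
open import Relation.Nullary.Decidable using (_×-dec_)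
open import Relation.Unary.Properties using (∁?; _∪?_)
import Relation.Unary as U
open import Relation.Binary using (Rel; Symmetric)
open import Level using (0ℓ)
import Relation.Binary as B
open import Relation.Binary.PropositionalEquality using (_≡_; _≢_; refl; sym; trans; cong; subst; ≢-sym)

module _ {n : ℕ} where

  open DecMembership (_≟_ {n}) using () renaming (_∈?_ to _∈ₗ?_)

  length≤∣p∣ : ∀ {p : Subset n} {xs} → Unique xs → All (_∈ p) xs → length xs ≤ ∣ p ∣
  length≤∣p∣ [] [] = z≤n
  length≤∣p∣ {p} {x ∷ _} (x∉xs ∷ u) (x∈p ∷ xs⊆p) =
    ≤-trans (s≤s (length≤∣p∣ u (All.zipWith drop-x (x∉xs , xs⊆p)))) (x∈p⇒∣p-x∣<∣p∣ x∈p)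
    where
    drop-x : ∀ {z} → x ≢ z × z ∈ p → z ∈ p - x
    drop-x (x≢z , z∈p) = x∈p∧x≢y⇒x∈p-y z∈p (≢-sym x≢z)

  ∈-exhaustive : ∀ {p : Subset n} {xs w} → Unique xs → All (_∈ p) xs → ∣ p ∣ ≤ length xs →
    w ∈ p → w ∈ₗ xs
  ∈-exhaustive {xs = xs} {w} u xs⊆p ∣p∣≤ w∈p with w ∈ₗ? xs
  ... | yes w∈xs = w∈xs
  ... | no w∉xs =
    ⊥-elim (<⇒≱ (length≤∣p∣ (All.¬Any⇒All¬ xs w∉xs ∷ u) (w∈p ∷ xs⊆p)) ∣p∣≤)

  ⊆-exhaustive : ∀ {p q : Subset n} {xs} → Unique xs → All (_∈ p) xs → All (_∈ q) xs →
    ∣ p ∣ ≤ length xs → p ⊆ q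
  ⊆-exhaustive u xs⊆p xs⊆q ∣p∣≤ w∈p = All.lookup xs⊆q (∈-exhaustive u xs⊆p ∣p∣≤ w∈p)

  length-filter-∈ : ∀ {A : Set} {p : Subset n} (f : A → Fin n) {xs} {ys : List A} →
    Unique xs → All (_∈ p) xs → AllPairs (λ a b → f a ≢ f b) ys →
    All (λ x → All (λ b → x ≢ f b) ys) xs →
    length xs + length (filter (λ b → f b ∈? p) ys) ≤ ∣ p ∣
  length-filter-∈ {A} {p} f {xs} {ys} u xs⊆p f-inj xs∉f[ys] = begin
    length xs + length hits              ≡⟨ cong (length xs +_) (sym (length-map f hits)) ⟩
    length xs + length (map f hits)      ≡⟨ sym (length-++ xs) ⟩
    length (xs ++ map f hits)            ≤⟨ length≤∣p∣ unique-all all-in-p ⟩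
    ∣ p ∣                                ∎
    where
    open ≤-Reasoning
    P? : U.Decidable (λ b → f b ∈ p)
    P? b = f b ∈? p
    hits : List A
    hits = filter P? ys
    all-in-p : All (_∈ p) (xs ++ map f hits)
    all-in-p = All.++⁺ xs⊆p (All.map⁺ (All.all-filter P? ys))
    unique-all : Unique (xs ++ map f hits)
    unique-all = AllPairs.++⁺ u (AllPairs.map⁺ (AllPairs.filter⁺ P? f-inj))
                   (All.map (λ x∉ → All.map⁺ (All.filter⁺ P? x∉)) xs∉f[ys])

module _ {A : Set} where

  two-members : ∀ {xs : List A} {a} → Unique xs → a ∈ₗ xs → length xs ≢ 1 →
    Σ A λ b → Σ A λ c → b ∈ₗ xs × c ∈ₗ xs × b ≢ c
  two-members {_ ∷ []} _ _ len≢1 = ⊥-elim (len≢1 refl)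
  two-members {b ∷ c ∷ _} ((b≢c ∷ _) ∷ _) _ _ = b , c , here refl , there (here refl) , b≢c

  length-filter-∪ : ∀ {P Q : A → Set} (P? : U.Decidable P) (Q? : U.Decidable Q) (xs : List A) →
    length (filter (P? ∪? Q?) xs) ≤ length (filter P? xs) + length (filter Q? xs)
  length-filter-∪ P? Q? [] = z≤n
  length-filter-∪ P? Q? (x ∷ xs) with P? x | Q? x | length-filter-∪ P? Q? xs
  ... | yes _ | yes _ | ih = s≤s (≤-trans ih (+-monoʳ-≤ _ (n≤1+n _)))
  ... | yes _ | no _  | ih = s≤s ih
  ... | no _  | yes _ | ih = ≤-trans (s≤s ih) (≤-reflexive (sym (+-suc _ _)))
  ... | no _  | no _  | ih = ih

  length-filter-∁ : ∀ {P : A → Set} (P? : U.Decidable P) (xs : List A) →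
    length xs ≡ length (filter P? xs) + length (filter (∁? P?) xs)
  length-filter-∁ P? [] = refl
  length-filter-∁ P? (x ∷ xs) with P? x
  ... | yes _ = cong suc (length-filter-∁ P? xs)
  ... | no _  = trans (cong suc (length-filter-∁ P? xs)) (sym (+-suc _ _))

  All-reverse⁺ : ∀ {P : A → Set} {xs} → All P xs → All P (reverse xs)
  All-reverse⁺ {xs = []} [] = []
  All-reverse⁺ {xs = x ∷ xs} (px ∷ pxs) rewrite unfold-reverse x xs = All.∷ʳ⁺ (All-reverse⁺ pxs) px

  AllPairs-reverse⁺ : ∀ {R : Rel A 0ℓ} {xs} → AllPairs R xs → AllPairs (flip R) (reverse xs)
  AllPairs-reverse⁺ {xs = []} [] = []
  AllPairs-reverse⁺ {xs = x ∷ xs} (Rx ∷ Rxs) rewrite unfold-reverse x xs =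
    AllPairs.++⁺ (AllPairs-reverse⁺ Rxs) ([] ∷ []) (All.map (_∷ []) (All-reverse⁺ Rx))

  AllPairs-lookup : ∀ {R : Rel A 0ℓ} → Symmetric R → ∀ {xs} → AllPairs R xs →
    ∀ {i j} → i ≢ j → R (lookup xs i) (lookup xs j)
  AllPairs-lookup sym-R (Rx ∷ _) {zero} {zero} i≢j = ⊥-elim (i≢j refl)
  AllPairs-lookup sym-R (Rx ∷ _) {zero} {suc j} _ = All.lookup Rx (∈-lookup j)
  AllPairs-lookup sym-R (Rx ∷ _) {suc i} {zero} _ = sym-R (All.lookup Rx (∈-lookup i))
  AllPairs-lookup sym-R (_ ∷ Rxs) {suc i} {suc j} i≢j =
    AllPairs-lookup sym-R Rxs (λ i≡j → i≢j (cong suc i≡j))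

module Greedy {A : Set} {D R : Rel A 0ℓ} (D-sym : Symmetric D) (R? : B.Decidable R) (d : ℕ)
  (out-degree≤d : ∀ {a xs} → AllPairs D (a ∷ xs) → length (filter (R? a) xs) ≤ d) where

  -- The first argument is fuel; the pass is complete once it is at least the length.
  greedy : ℕ → List A → List A
  greedy zero    _        = []
  greedy (suc k) []       = []
  greedy (suc k) (a ∷ xs) = a ∷ greedy k (filter (∁? (R? a)) xs)

  greedy-All : ∀ {P : A → Set} k xs → All P xs → All P (greedy k xs)
  greedy-All zero    _        _          = []
  greedy-All (suc k) []       _          = []
  greedy-All (suc k) (a ∷ xs) (pa ∷ pxs) = pa ∷ greedy-All k _ (All.filter⁺ (∁? (R? a)) pxs)

  greedy-AllPairs : ∀ {S : Rel A 0ℓ} k xs → AllPairs S xs → AllPairs S (greedy k xs)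
  greedy-AllPairs zero    _        _            = []
  greedy-AllPairs (suc k) []       _            = []
  greedy-AllPairs (suc k) (a ∷ xs) (Sa ∷ Sxs) =
    greedy-All k _ (All.filter⁺ (∁? (R? a)) Sa) ∷ greedy-AllPairs k _ (AllPairs.filter⁺ (∁? (R? a)) Sxs)

  greedy-forward : ∀ k xs → AllPairs (λ a b → ¬ R a b) (greedy k xs)
  greedy-forward zero    _        = []
  greedy-forward (suc k) []       = []
  greedy-forward (suc k) (a ∷ xs) = greedy-All k _ (All.all-filter (∁? (R? a)) xs) ∷ greedy-forward k _

  greedy-length : ∀ k xs → length xs ≤ k → AllPairs D xs → length xs ≤ suc d * length (greedy k xs)
  greedy-length zero    []       _        _          = z≤n
  greedy-length (suc k) []       _        _          = z≤n
  greedy-length (suc k) (a ∷ xs) (s≤s len≤k) Dxs@(_ ∷ Dxs′) = begin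
    suc (length xs)                                           ≡⟨ cong suc (length-filter-∁ (R? a) xs) ⟩
    suc (length (filter (R? a) xs) + length rest)             ≤⟨ s≤s (+-mono-≤ (out-degree≤d Dxs) ih) ⟩
    suc (d + suc d * length (greedy k rest))                  ≡⟨ sym (*-suc (suc d) _) ⟩
    suc d * suc (length (greedy k rest))                      ∎
    where
    open ≤-Reasoning
    rest : List A
    rest = filter (∁? (R? a)) xs
    ih : length rest ≤ suc d * length (greedy k rest)
    ih = greedy-length k rest (≤-trans (length-filter (∁? (R? a)) xs) len≤k)
                                (AllPairs.filter⁺ (∁? (R? a)) Dxs′)

  Independent : Rel A 0ℓ
  Independent a b = D a b × ¬ R a b × ¬ R b a

  Independent-sym : Symmetric Independent
  Independent-sym (Dab , ¬Rab , ¬Rba) = D-sym Dab , ¬Rba , ¬Rab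

  independent-sublist : ∀ xs → AllPairs D xs →
    Σ (List A) λ ys → AllPairs Independent ys × length xs ≤ suc d * (suc d * length ys)
  independent-sublist xs Dxs = ys , independent , bound
    where
    open ≤-Reasoning
    -- A pass forbids hits from earlier to later elements; the second pass runs over the
    -- reversed output of the first, so the surviving elements have no hits either way.
    forward zs ys : List A
    forward = greedy (length xs) xs
    zs = reverse forward
    ys = greedy (length zs) zs
    Dzs : AllPairs D zs
    Dzs = AllPairs.map D-sym (AllPairs-reverse⁺ (greedy-AllPairs (length xs) xs Dxs))
    backward : AllPairs (λ a b → ¬ R b a) zs
    backward = AllPairs-reverse⁺ (greedy-forward (length xs) xs)
    independent : AllPairs Independent ys
    independent = AllPairs.zip (greedy-AllPairs (length zs) zs Dzs , AllPairs.zip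
      (greedy-forward (length zs) zs , greedy-AllPairs (length zs) zs backward))
    bound : length xs ≤ suc d * (suc d * length ys)
    bound = begin
      length xs                     ≤⟨ greedy-length _ xs ≤-refl Dxs ⟩
      suc d * length forward        ≡⟨ cong (suc d *_) (sym (length-reverse forward)) ⟩
      suc d * length zs             ≤⟨ *-monoʳ-≤ (suc d) (greedy-length _ zs ≤-refl Dzs) ⟩
      suc d * (suc d * length ys)   ∎

proj₁-toList : ∀ {A : Set} {P : A → Set} {xs} (pxs : All P xs) → map proj₁ (All.toList pxs) ≡ xs
proj₁-toList []         = refl
proj₁-toList (px ∷ pxs) = cong (_ ∷_) (proj₁-toList pxs)

9m≤[t∸1][6t∸2] : ∀ {t m} → 3 ≤ t → m < t → 3 * (3 * m) ≤ (t ∸ 1) * (6 * t ∸ 2)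
9m≤[t∸1][6t∸2] {t} {m} 3≤t m<t = begin
  3 * (3 * m)            ≡⟨ sym (*-assoc 3 3 m) ⟩
  9 * m                  ≤⟨ *-monoʳ-≤ 9 (∸-monoˡ-≤ 1 m<t) ⟩
  9 * (t ∸ 1)            ≤⟨ *-monoˡ-≤ (t ∸ 1) 9≤6t∸2 ⟩
  (6 * t ∸ 2) * (t ∸ 1)  ≡⟨ *-comm (6 * t ∸ 2) (t ∸ 1) ⟩
  (t ∸ 1) * (6 * t ∸ 2)  ∎
  where
  open ≤-Reasoning
  9≤6t∸2 : 9 ≤ 6 * t ∸ 2
  9≤6t∸2 = ≤-trans (m≤m+n 9 7) (∸-monoˡ-≤ 2 (*-monoʳ-≤ 6 3≤t))

module _ {n : ℕ} (H : Hypergraph n) (uniform : Uniform3 H) where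

  edges-sharing-three-vertices : ∀ {e f u v w} → e ∈ₗ edges H → f ∈ₗ edges H →
    Unique (u ∷ v ∷ w ∷ []) → All (_∈ e) (u ∷ v ∷ w ∷ []) → All (_∈ f) (u ∷ v ∷ w ∷ []) →
    e ≡ f
  edges-sharing-three-vertices e∈H f∈H distinct ⊆e ⊆f = ⊆-antisym
    (⊆-exhaustive distinct ⊆e ⊆f (≤-reflexive (All.lookup uniform e∈H)))
    (⊆-exhaustive distinct ⊆f ⊆e (≤-reflexive (All.lookup uniform f∈H)))

  record EdgeThrough (u z w : Fin n) : Set where
    field
      edge   : Subset n
      edge∈H : edge ∈ₗ edges H
      u∈edge : u ∈ edge
      z∈edge : z ∈ edge
      w∉edge : w ∉ edge
  open EdgeThrough

  contains-both? : (u z : Fin n) → U.Decidable (λ e → u ∈ e × z ∈ e)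
  contains-both? u z e = (u ∈? e) ×-dec (z ∈? e)

  N₁-codeg≢1 : ∀ {u z} → InN1 H u z → codeg H u z ≢ 1
  N₁-codeg≢1 {u} {z} (z≢u , _ , (_ , no-codeg1-pair) , u∈e , z∈e) codeg≡1 =
    no-codeg1-pair (u , z , ≢-sym z≢u , u∈e , z∈e , codeg≡1)

  two-edges-through : ∀ {u z} → InN1 H u z → Σ (Subset n) λ e₁ → Σ (Subset n) λ e₂ →
    e₁ ≢ e₂ × (e₁ ∈ₗ edges H × u ∈ e₁ × z ∈ e₁) × (e₂ ∈ₗ edges H × u ∈ e₂ × z ∈ e₂)
  two-edges-through {u} {z} u~z@(_ , _ , (e∈H , _) , u∈e , z∈e)
    with two-members (Unique.filter⁺ (contains-both? u z) (unique H))
                     (∈-filter⁺ (contains-both? u z) e∈H (u∈e , z∈e)) (N₁-codeg≢1 u~z)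
  ... | e₁ , e₂ , e₁∈ , e₂∈ , e₁≢e₂ =
    e₁ , e₂ , e₁≢e₂ , ∈-filter⁻ (contains-both? u z) e₁∈ , ∈-filter⁻ (contains-both? u z) e₂∈

  edge-through : ∀ {u z w} → InN1 H u z → w ≢ u → w ≢ z → EdgeThrough u z w
  edge-through {u} {z} {w} u~z@(z≢u , _) w≢u w≢z with two-edges-through u~z
  ... | e₁ , e₂ , e₁≢e₂ , (e₁∈H , u∈e₁ , z∈e₁) , (e₂∈H , u∈e₂ , z∈e₂)
    with w ∈? e₁ | w ∈? e₂
  ...   | no w∉e₁ | _ = record
    { edge = e₁ ; edge∈H = e₁∈H ; u∈edge = u∈e₁ ; z∈edge = z∈e₁ ; w∉edge = w∉e₁ }
  ...   | yes _ | no w∉e₂ = record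
    { edge = e₂ ; edge∈H = e₂∈H ; u∈edge = u∈e₂ ; z∈edge = z∈e₂ ; w∉edge = w∉e₂ }
  ...   | yes w∈e₁ | yes w∈e₂ =
    ⊥-elim (e₁≢e₂ (edges-sharing-three-vertices e₁∈H e₂∈H distinct
      (u∈e₁ ∷ z∈e₁ ∷ w∈e₁ ∷ []) (u∈e₂ ∷ z∈e₂ ∷ w∈e₂ ∷ [])))
    where
    distinct : Unique (u ∷ z ∷ w ∷ [])
    distinct = (≢-sym z≢u ∷ ≢-sym w≢u ∷ []) ∷ (≢-sym w≢z ∷ []) ∷ [] ∷ []

  module CommonNeighbours {x y : Fin n} (x≢y : x ≢ y) where

    record CommonNeighbour (z : Fin n) : Set where
      field
        z≢x      : z ≢ x
        z≢y      : z ≢ y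
        throughˣ : EdgeThrough x z y
        throughʸ : EdgeThrough y z x
    open CommonNeighbour

    common-neighbour : ∀ {z} → InN1 H x z × InN1 H y z → CommonNeighbour z
    common-neighbour (x~z@(z≢x , _) , y~z@(z≢y , _)) = record
      { z≢x = z≢x
      ; z≢y = z≢y
      ; throughˣ = edge-through x~z (≢-sym x≢y) (≢-sym z≢y)
      ; throughʸ = edge-through y~z x≢y (≢-sym z≢x)
      }

    Vertex : Set
    Vertex = Σ (Fin n) CommonNeighbour

    Distinct : Rel Vertex 0ℓ
    Distinct a b = proj₁ a ≢ proj₁ b

    Hits : Rel Vertex 0ℓ
    Hits a b = proj₁ b ∈ edge (throughˣ (proj₂ a)) ⊎ proj₁ b ∈ edge (throughʸ (proj₂ a))

    hits? : B.Decidable Hits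
    hits? a = (λ b → proj₁ b ∈? edge (throughˣ (proj₂ a)))
           ∪? (λ b → proj₁ b ∈? edge (throughʸ (proj₂ a)))

    edge-meets-at-most-one : ∀ {u w a bs} (E : EdgeThrough u (proj₁ a) w) →
      (∀ (b : Vertex) → proj₁ b ≢ u) → AllPairs Distinct (a ∷ bs) →
      length (filter (λ b → proj₁ b ∈? edge E) bs) ≤ 1
    edge-meets-at-most-one {u} {a = a} {bs} E avoids-u (a≢bs ∷ bs-distinct) =
      s≤s⁻¹ (s≤s⁻¹ (begin
        2 + length (filter (λ b → proj₁ b ∈? edge E) bs)
          ≤⟨ length-filter-∈ proj₁ u≢a (u∈edge E ∷ z∈edge E ∷ []) bs-distinct
               (All.tabulate (λ {b} _ → ≢-sym (avoids-u b)) ∷ a≢bs ∷ []) ⟩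
        ∣ edge E ∣
          ≡⟨ All.lookup uniform (edge∈H E) ⟩
        3 ∎))
      where
      open ≤-Reasoning
      u≢a : Unique (u ∷ proj₁ a ∷ [])
      u≢a = (≢-sym (avoids-u a) ∷ []) ∷ [] ∷ []

    hits-at-most-two : ∀ {a bs} → AllPairs Distinct (a ∷ bs) → length (filter (hits? a) bs) ≤ 2
    hits-at-most-two {a} {bs} distinct = ≤-trans (length-filter-∪ _ _ bs) (+-mono-≤
      (edge-meets-at-most-one (throughˣ (proj₂ a)) (λ b → z≢x (proj₂ b)) distinct)
      (edge-meets-at-most-one (throughʸ (proj₂ a)) (λ b → z≢y (proj₂ b)) distinct))

    open Greedy {D = Distinct} ≢-sym hits? 2 hits-at-most-two

    K₂,ₜ-trace : ∀ {t} (v : Fin t → Vertex) → (∀ {j l} → j ≢ l → Independent (v j) (v l)) →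
      ContainsK2tTrace t H
    K₂,ₜ-trace {t} v independent =
      a , b , f , a-injective , b-injective , a≢b , f∈H , f-injective , λ i j → a∈f⇔ i j , b∈f⇔ i j
      where
      a : Fin 2 → Fin n
      a zero       = x
      a (suc zero) = y
      b : Fin t → Fin n
      b j = proj₁ (v j)
      Eˣ : (j : Fin t) → EdgeThrough x (b j) y
      Eˣ j = throughˣ (proj₂ (v j))
      Eʸ : (j : Fin t) → EdgeThrough y (b j) x
      Eʸ j = throughʸ (proj₂ (v j))
      f : Fin 2 → Fin t → Subset n
      f zero       j = edge (Eˣ j)
      f (suc zero) j = edge (Eʸ j)

      a-injective : ∀ i₁ i₂ → a i₁ ≡ a i₂ → i₁ ≡ i₂
      a-injective zero       zero       _   = refl
      a-injective zero       (suc zero) x≡y = ⊥-elim (x≢y x≡y)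
      a-injective (suc zero) zero       y≡x = ⊥-elim (x≢y (sym y≡x))
      a-injective (suc zero) (suc zero) _   = refl

      b-injective : ∀ j l → b j ≡ b l → j ≡ l
      b-injective j l bj≡bl with j ≟ l
      ... | yes j≡l = j≡l
      ... | no j≢l  = ⊥-elim (proj₁ (independent j≢l) bj≡bl)

      a≢b : ∀ i j → a i ≢ b j
      a≢b zero       j x≡bj = z≢x (proj₂ (v j)) (sym x≡bj)
      a≢b (suc zero) j y≡bj = z≢y (proj₂ (v j)) (sym y≡bj)

      f∈H : ∀ i j → f i j ∈ₗ edges H
      f∈H zero       j = edge∈H (Eˣ j)
      f∈H (suc zero) j = edge∈H (Eʸ j)

      a∈f : ∀ i j → a i ∈ f i j
      a∈f zero       j = u∈edge (Eˣ j)
      a∈f (suc zero) j = u∈edge (Eʸ j)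

      b∈f : ∀ i j → b j ∈ f i j
      b∈f zero       j = z∈edge (Eˣ j)
      b∈f (suc zero) j = z∈edge (Eʸ j)

      a∈f⇔ : ∀ i j k → (a k ∈ f i j) ⇔ (k ≡ i)
      a∈f⇔ zero       j zero       = mk⇔ (λ _ → refl) (λ _ → a∈f zero j)
      a∈f⇔ zero       j (suc zero) = mk⇔ (λ y∈f → ⊥-elim (w∉edge (Eˣ j) y∈f)) (λ ())
      a∈f⇔ (suc zero) j zero       = mk⇔ (λ x∈f → ⊥-elim (w∉edge (Eʸ j) x∈f)) (λ ())
      a∈f⇔ (suc zero) j (suc zero) = mk⇔ (λ _ → refl) (λ _ → a∈f (suc zero) j)

      hits : ∀ i j l → b l ∈ f i j → Hits (v j) (v l)
      hits zero       j l = inj₁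
      hits (suc zero) j l = inj₂

      b∈f⇔ : ∀ i j l → (b l ∈ f i j) ⇔ (l ≡ j)
      b∈f⇔ i j l = mk⇔ only-j (λ { refl → b∈f i j })
        where
        only-j : b l ∈ f i j → l ≡ j
        only-j bl∈f with l ≟ j
        ... | yes l≡j = l≡j
        ... | no l≢j  = ⊥-elim (proj₁ (proj₂ (independent (≢-sym l≢j))) (hits i j l bl∈f))

      f-injective : ∀ i₁ j₁ i₂ j₂ → f i₁ j₁ ≡ f i₂ j₂ → i₁ ≡ i₂ × j₁ ≡ j₂
      f-injective i₁ j₁ i₂ j₂ f₁≡f₂ =
        Equivalence.to (a∈f⇔ i₂ j₂ i₁) (subst (a i₁ ∈_) f₁≡f₂ (a∈f i₁ j₁)) ,
        Equivalence.to (b∈f⇔ i₂ j₂ j₁) (subst (b j₁ ∈_) f₁≡f₂ (b∈f i₁ j₁))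

    independent-lists-are-short : ∀ {t vs} → ¬ ContainsK2tTrace t H → AllPairs Independent vs →
      length vs < t
    independent-lists-are-short {t} {vs} no-trace independent with t ≤? length vs
    ... | no t≰vs  = ≰⇒> t≰vs
    ... | yes t≤vs = ⊥-elim (no-trace (K₂,ₜ-trace
      (λ j → lookup vs (inject≤ j t≤vs))
      (λ j≢l → AllPairs-lookup (λ {a b} → Independent-sym {a} {b}) independent
                 (λ eq → j≢l (inject≤-injective _ _ _ _ eq)))))

    independent-common-neighbours : ∀ {zs} → Unique zs → All (λ z → InN1 H x z × InN1 H y z) zs →
      Σ (List Vertex) λ vs → AllPairs Independent vs × length zs ≤ 3 * (3 * length vs)
    independent-common-neighbours {zs} unique-zs common =
      Product.map₂ (Product.map₂ (≤-trans (≤-reflexive same-length)))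
                   (independent-sublist vertices distinct)
      where
      neighbours : All CommonNeighbour zs
      neighbours = All.map common-neighbour common
      vertices : List Vertex
      vertices = All.toList neighbours
      distinct : AllPairs Distinct vertices
      distinct = AllPairs.map⁻ (subst Unique (sym (proj₁-toList neighbours)) unique-zs)
      same-length : length zs ≡ length vertices
      same-length = trans (cong length (sym (proj₁-toList neighbours))) (length-map proj₁ vertices)

mainTheorem4 : (t n : ℕ) → 3 ≤ t → (H : Hypergraph n) → Uniform3 H →
    ¬ ContainsK2tTrace t H →
    (x y : Fin n) → x ≢ y →
    (zs : List (Fin n)) → Unique zs → All (λ z → InN1 H x z × InN1 H y z) zs →
    length zs ≤ (t ∸ 1) * (6 * t ∸ 2)
mainTheorem4 t n 3≤t H uniform no-trace x y x≢y zs unique-zs common =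
  let vs , independent , zs≤9vs = independent-common-neighbours unique-zs common
  in  ≤-trans zs≤9vs (9m≤[t∸1][6t∸2] 3≤t (independent-lists-are-short no-trace independent))
  where open CommonNeighbours H uniform x≢y
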